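{- Let $P=(X,\leq_P)$ be a connected finite poset with more than one point, let $Q$ be a finite flat poset, and let $f:E(P)\to Q$ be an order homomorphism. If $Q$ does not contain a 4-crown, then there exists an order homomorphism $g:P\to Q$ with $g|_{E(P)}=f$. In particular, if $C\subseteq E(P)$ is a crown with more than four points, then $C$ is a retract of $P$ if and only if $C$ is a retract of $E(P)$.
   Context: Subsets of a poset are identified with induced subposets. $L(P)$, $U(P)$ denote the sets of minimal and maximal points of $P$, and $E(P)=L(P)\cup U(P)$ (as induced subposet). A poset is flat if its height (maximal length of a chain, where a chain with $k$ elements has length $k-1$) is one. A subset $Y$ is a crown if its comparability graph (vertices $Y$, edges between distinct comparable elements) is a cycle; a 4-crown is a crown with 4 points. A retraction of $P$ is an idempotent order homomorphism $r:P\to P$; its image is a retract of $P$. -}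

module Defs where

open import Data.Nat using (ℕ; suc; zero)
open import Data.Fin using (Fin; toℕ)
open import Data.Product using (Σ; ∃; _×_; _,_)
open import Data.Sum using (_⊎_)
open import Relation.Nullary using (¬_)
open import Relation.Binary using (IsPartialOrder; Decidable)
open import Relation.Binary.PropositionalEquality using (_≡_; _≢_)
open import Relation.Binary.Construct.Closure.ReflexiveTransitive using (Star)
open import Function.Definitions using (Injective)

record FinPoset : Set₁ where
  field
    size           : ℕ
    _≼_            : Fin size → Fin size → Set
    isPartialOrder : IsPartialOrder _≡_ _≼_
    _≼?_           : Decidable _≼_

  Pt : Set
  Pt = Fin size

  _≺_ : Pt → Pt → Set
  x ≺ y = (x ≼ y) × (x ≢ y)

  Comparable : Pt → Pt → Set
  Comparable x y = (x ≼ y) ⊎ (y ≼ x)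

  Connected : Set
  Connected = ∀ x y → Star Comparable x y

  IsMinimal : Pt → Set
  IsMinimal x = ∀ y → y ≼ x → y ≡ x

  IsMaximal : Pt → Set
  IsMaximal x = ∀ y → x ≼ y → y ≡ x

  InE : Pt → Set
  InE x = IsMinimal x ⊎ IsMaximal x

  Flat : Set
  Flat = (∃ λ x → ∃ λ y → x ≺ y)
       × ¬ (∃ λ x → ∃ λ y → ∃ λ z → (x ≺ y) × (y ≺ z))

  Edge : Pt → Pt → Set
  Edge x y = (x ≢ y) × Comparable x y

  Contains4Crown : Set
  Contains4Crown =
    ∃ λ a → ∃ λ b → ∃ λ c → ∃ λ d →
      (a ≢ b) × (a ≢ c) × (a ≢ d) × (b ≢ c) × (b ≢ d) × (c ≢ d)
      × Edge a b × Edge b c × Edge c d × Edge d a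
      × ¬ Edge a c × ¬ Edge b d

open FinPoset public

CycSucc : (k : ℕ) → Fin k → Fin k → Set
CycSucc k i j = (suc (toℕ i) ≡ toℕ j) ⊎ ((suc (toℕ i) ≡ k) × (toℕ j ≡ 0))

CycAdj : (k : ℕ) → Fin k → Fin k → Set
CycAdj k i j = CycSucc k i j ⊎ CycSucc k j i

IsCrown : (P : FinPoset) (k : ℕ) → (Fin k → Pt P) → Set
IsCrown P k c =
  (3 Data.Nat.≤ k) × Injective _≡_ _≡_ c
  × (∀ i j → i ≢ j → (Comparable P (c i) (c j) → CycAdj k i j)
                     × (CycAdj k i j → Comparable P (c i) (c j)))

Hom : (P Q : FinPoset) → (Pt P → Pt Q) → Set
Hom P Q g = ∀ x y → _≼_ P x y → _≼_ Q (g x) (g y)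

-- order homomorphism E(P) → Q, a map on E(P) encoded as a map on P whose
-- values outside E(P) are irrelevant
HomOnE : (P Q : FinPoset) → (Pt P → Pt Q) → Set
HomOnE P Q f = ∀ x y → InE P x → InE P y → _≼_ P x y → _≼_ Q (f x) (f y)

RetractOf : (P : FinPoset) (k : ℕ) → (Fin k → Pt P) → Set
RetractOf P k c =
  Σ (Pt P → Pt P) λ r →
    Hom P P r
    × (∀ x → r (r x) ≡ r x)
    × (∀ x → ∃ λ i → r x ≡ c i)
    × (∀ i → ∃ λ x → r x ≡ c i)

RetractOfE : (P : FinPoset) (k : ℕ) → (Fin k → Pt P) → Set
RetractOfE P k c =
  Σ (Pt P → Pt P) λ r →
    (∀ x → InE P x → InE P (r x))
    × HomOnE P P r
    × (∀ x → InE P x → r (r x) ≡ r x)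
    × (∀ x → InE P x → ∃ λ i → r x ≡ c i)
    × (∀ i → ∃ λ x → InE P x × (r x ≡ c i))

{-# OPTIONS --safe #-}
module Submission where

-- In a poset Q of height at most one without 4-crowns, two distinct points
-- have at most one common upper bound.  So, for x ∉ E(P), either f takes a
-- single value on the minimal points below x, and x is sent there, or it
-- takes two distinct values, whose unique common upper bound is then f b for
-- every maximal b ≥ x, and x is sent there.  For the second part, the
-- points of a crown C ⊆ E(P) form a poset of height one, without 4-crowns
-- when |C| > 4, so a retraction of E(P) onto C extends to all of P.

open import Defs
open import Data.Nat using (ℕ; _<_; suc; s≤s)
open import Data.Nat.Properties using (suc-injective; <-irrefl)
open import Data.Fin using (Fin) renaming (_≟_ to _≟ᶠ_)
open import Data.Fin.Properties using (toℕ-injective; toℕ<n; any?; all?)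
open import Data.Fin.Induction using (po-wellFounded)
open import Induction.WellFounded using (Acc; acc)
open import Data.Product using (Σ; ∃; ∃₂; _×_; _,_; proj₁; proj₂)
open import Data.Sum using (_⊎_; inj₁; inj₂)
open import Data.Empty using (⊥; ⊥-elim)
open import Function using (_∘_; flip)
open import Function.Bundles using (_⇔_; mk⇔)
open import Function.Definitions using (Injective)
open import Relation.Nullary using (¬_; Dec; yes; no)
open import Relation.Nullary.Decidable using (_×-dec_; _⊎-dec_; _→-dec_; ¬?; decidable-stable)
open import Relation.Binary using (IsPartialOrder)
import Relation.Binary.Construct.Flip.EqAndOrd as Flip
open import Relation.Binary.PropositionalEquality
  using (_≡_; _≢_; refl; sym; trans; subst; subst₂; cong; isEquivalence; ≢-sym)

dual : FinPoset → FinPoset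
dual P = record
  { size           = size P
  ; _≼_            = flip (_≼_ P)
  ; isPartialOrder = Flip.isPartialOrder (isPartialOrder P)
  ; _≼?_           = flip (_≼?_ P)
  }

HeightAtMost1 : FinPoset → Set
HeightAtMost1 Q = ¬ (∃ λ x → ∃ λ y → ∃ λ z → _≺_ Q x y × _≺_ Q y z)

module _ (P : FinPoset) where
  open FinPoset P using () renaming (_≼_ to _≤_; _≼?_ to _≤?_)
  open IsPartialOrder (isPartialOrder P) using () renaming (refl to ≤-refl; trans to ≤-trans)

  isMinimal? : ∀ x → Dec (IsMinimal P x)
  isMinimal? x = all? λ y → (y ≤? x) →-dec (y ≟ᶠ x)

  minimal-below : ∀ x → ∃ λ a → IsMinimal P a × a ≤ x
  minimal-below x = go x (po-wellFounded (isPartialOrder P) x)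
    where
    go : ∀ x → Acc (_≺_ P) x → ∃ λ a → IsMinimal P a × a ≤ x
    go x (acc below) with any? (λ y → (y ≤? x) ×-dec ¬? (y ≟ᶠ x))
    ... | yes (y , y≺x) =
      let a , a-min , a≤y = go y (below y≺x) in a , a-min , ≤-trans a≤y (proj₁ y≺x)
    ... | no ∄y≺x =
      x , (λ y y≤x → decidable-stable (y ≟ᶠ x) λ y≢x → ∄y≺x (y , y≤x , y≢x)) , ≤-refl

maximal-above : (P : FinPoset) → ∀ x → ∃ λ b → IsMaximal P b × _≼_ P x b
maximal-above P = minimal-below (dual P)

inE? : (P : FinPoset) → ∀ x → Dec (InE P x)
inE? P x = isMinimal? P x ⊎-dec isMinimal? (dual P) x

module _ (Q : FinPoset) (height≤1 : HeightAtMost1 Q) where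
  open FinPoset Q using () renaming (_≼_ to _⊑_; _≺_ to _⊏_)

  ⊏-⊑⇒≡ : ∀ {x y z} → x ⊏ y → y ⊑ z → y ≡ z
  ⊏-⊑⇒≡ {x} {y} {z} x⊏y y⊑z =
    decidable-stable (y ≟ᶠ z) λ y≢z → height≤1 (x , y , z , x⊏y , y⊑z , y≢z)

  common-upper-bound-unique : ¬ Contains4Crown Q → ∀ {p p' q q'} → p ≢ p' →
    p ⊑ q → p' ⊑ q → p ⊑ q' → p' ⊑ q' → q ≡ q'
  common-upper-bound-unique no4 {p} {p'} {q} {q'} p≢p' p⊑q p'⊑q p⊑q' p'⊑q' =
    decidable-stable (q ≟ᶠ q') λ q≢q' → no4 (crown q≢q')
    where
    lower≢upper : ∀ {a b u v} → b ≢ a → b ⊑ u → a ⊑ v → u ≢ v → a ≢ u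
    lower≢upper b≢a b⊑a a⊑v u≢v refl = u≢v (⊏-⊑⇒≡ (b⊑a , b≢a) a⊑v)

    crown : q ≢ q' → Contains4Crown Q
    crown q≢q' =
      p , q , p' , q' , p≢q , p≢p' , p≢q' , ≢-sym p'≢q , q≢q' , p'≢q'
      , (p≢q , inj₁ p⊑q) , (≢-sym p'≢q , inj₂ p'⊑q)
      , (p'≢q' , inj₁ p'⊑q') , (≢-sym p≢q' , inj₂ p⊑q')
      , p≁p' , q≁q'
      where
      p≢q   = lower≢upper (≢-sym p≢p') p'⊑q p⊑q' q≢q'
      p'≢q  = lower≢upper p≢p' p⊑q p'⊑q' q≢q'
      p≢q'  = lower≢upper (≢-sym p≢p') p'⊑q' p⊑q (≢-sym q≢q')
      p'≢q' = lower≢upper p≢p' p⊑q' p'⊑q (≢-sym q≢q')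

      p≁p' : ¬ Edge Q p p'
      p≁p' (_ , inj₁ p⊑p') = p'≢q (⊏-⊑⇒≡ (p⊑p' , p≢p') p'⊑q)
      p≁p' (_ , inj₂ p'⊑p) = p≢q (⊏-⊑⇒≡ (p'⊑p , ≢-sym p≢p') p⊑q)

      q≁q' : ¬ Edge Q q q'
      q≁q' (_ , inj₁ q⊑q') = q≢q' (⊏-⊑⇒≡ (p⊑q , p≢q) q⊑q')
      q≁q' (_ , inj₂ q'⊑q) = q≢q' (sym (⊏-⊑⇒≡ (p⊑q' , p≢q') q'⊑q))

module Extension (P Q : FinPoset) (height≤1 : HeightAtMost1 Q) (no4 : ¬ Contains4Crown Q)
                 (f : Pt P → Pt Q) (f-hom : HomOnE P Q f) where
  open FinPoset P using () renaming (_≼_ to _≤_; _≼?_ to _≤?_)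
  open FinPoset Q using () renaming (_≼_ to _⊑_)
  open IsPartialOrder (isPartialOrder P) using () renaming (trans to ≤-trans)
  open IsPartialOrder (isPartialOrder Q) using () renaming (reflexive to ⊑-reflexive)

  low high : Pt P → Pt P
  low x = proj₁ (minimal-below P x)
  high x = proj₁ (maximal-above P x)

  low-minimal : ∀ x → IsMinimal P (low x)
  low-minimal x = proj₁ (proj₂ (minimal-below P x))

  low≤ : ∀ x → low x ≤ x
  low≤ x = proj₂ (proj₂ (minimal-below P x))

  high-maximal : ∀ x → IsMaximal P (high x)
  high-maximal x = proj₁ (proj₂ (maximal-above P x))

  ≤high : ∀ x → x ≤ high x
  ≤high x = proj₂ (proj₂ (maximal-above P x))

  f-mono-through : ∀ {a x b} → IsMinimal P a → IsMaximal P b → a ≤ x → x ≤ b → f a ⊑ f b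
  f-mono-through {a} {x} {b} a-min b-max a≤x x≤b =
    f-hom a b (inj₁ a-min) (inj₂ b-max) (≤-trans a≤x x≤b)

  Split : Pt P → Set
  Split x = ∃₂ λ a a' → IsMinimal P a × IsMinimal P a' × a ≤ x × a' ≤ x × f a ≢ f a'

  split? : ∀ x → Dec (Split x)
  split? x = any? λ a → any? λ a' →
    isMinimal? P a ×-dec isMinimal? P a' ×-dec (a ≤? x) ×-dec (a' ≤? x) ×-dec ¬? (f a ≟ᶠ f a')

  split-mono : ∀ {x y} → x ≤ y → Split x → Split y
  split-mono x≤y (a , a' , a-min , a'-min , a≤x , a'≤x , fa≢fa') =
    a , a' , a-min , a'-min , ≤-trans a≤x x≤y , ≤-trans a'≤x x≤y , fa≢fa'

  unsplit-constant : ∀ {x a a'} → ¬ Split x → IsMinimal P a → IsMinimal P a' →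
    a ≤ x → a' ≤ x → f a ≡ f a'
  unsplit-constant {x} {a} {a'} ¬split a-min a'-min a≤x a'≤x =
    decidable-stable (f a ≟ᶠ f a') λ fa≢fa' → ¬split (a , a' , a-min , a'-min , a≤x , a'≤x , fa≢fa')

  inner : Pt P → Pt Q
  inner x with split? x
  ... | yes _ = f (high x)
  ... | no  _ = f (low x)

  f≤inner : ∀ {a y} → IsMinimal P a → a ≤ y → f a ⊑ inner y
  f≤inner {a} {y} a-min a≤y with split? y
  ... | yes _      = f-mono-through a-min (high-maximal y) a≤y (≤high y)
  ... | no ¬split = ⊑-reflexive (unsplit-constant ¬split a-min (low-minimal y) a≤y (low≤ y))

  split⇒f-high≤f : ∀ {x b} → Split x → IsMaximal P b → x ≤ b → f (high x) ⊑ f b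
  split⇒f-high≤f {x} (a , a' , a-min , a'-min , a≤x , a'≤x , fa≢fa') b-max x≤b =
    ⊑-reflexive (common-upper-bound-unique Q height≤1 no4 fa≢fa'
      (f-mono-through a-min (high-maximal x) a≤x (≤high x))
      (f-mono-through a'-min (high-maximal x) a'≤x (≤high x))
      (f-mono-through a-min b-max a≤x x≤b)
      (f-mono-through a'-min b-max a'≤x x≤b))

  inner≤f : ∀ {x b} → IsMaximal P b → x ≤ b → inner x ⊑ f b
  inner≤f {x} b-max x≤b with split? x
  ... | yes split = split⇒f-high≤f split b-max x≤b
  ... | no _      = f-mono-through (low-minimal x) b-max (low≤ x) x≤b

  inner-split : ∀ {x} → Split x → inner x ≡ f (high x)
  inner-split {x} split with split? x
  ... | yes _      = refl
  ... | no ¬split = ⊥-elim (¬split split)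

  inner-mono : ∀ {x y} → x ≤ y → inner x ⊑ inner y
  inner-mono {x} {y} x≤y with split? x
  ... | no _ = f≤inner (low-minimal x) (≤-trans (low≤ x) x≤y)
  ... | yes split =
    subst (f (high x) ⊑_) (sym (inner-split (split-mono x≤y split)))
      (split⇒f-high≤f split (high-maximal y) (≤-trans x≤y (≤high y)))

  extension : Pt P → Pt Q
  extension x with inE? P x
  ... | yes _ = f x
  ... | no  _ = inner x

  extension-hom : Hom P Q extension
  extension-hom x y x≤y with inE? P x | inE? P y
  ... | yes x∈E          | yes y∈E          = f-hom x y x∈E y∈E x≤y
  ... | yes (inj₁ x-min) | no _             = f≤inner x-min x≤y
  ... | yes (inj₂ x-max) | no y∉E           = ⊥-elim (y∉E (subst (InE P) (sym (x-max y x≤y)) (inj₂ x-max)))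
  ... | no _             | yes (inj₂ y-max) = inner≤f y-max x≤y
  ... | no x∉E           | yes (inj₁ y-min) = ⊥-elim (x∉E (subst (InE P) (sym (y-min x x≤y)) (inj₁ y-min)))
  ... | no _             | no _             = inner-mono x≤y

  extension-agrees : ∀ x → InE P x → extension x ≡ f x
  extension-agrees x x∈E with inE? P x
  ... | yes _  = refl
  ... | no x∉E = ⊥-elim (x∉E x∈E)

extension-from-E : (P Q : FinPoset) → HeightAtMost1 Q → ¬ Contains4Crown Q →
  (f : Pt P → Pt Q) → HomOnE P Q f →
  Σ (Pt P → Pt Q) λ g → Hom P Q g × (∀ x → InE P x → g x ≡ f x)
extension-from-E P Q height≤1 no4 f f-hom = extension , extension-hom , extension-agrees
  where open Extension P Q height≤1 no4 f f-hom

induced : (P : FinPoset) {k : ℕ} (c : Fin k → Pt P) → Injective _≡_ _≡_ c → FinPoset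
induced P {k} c c-injective = record
  { size           = k
  ; _≼_            = λ i j → _≼_ P (c i) (c j)
  ; isPartialOrder = record
    { isPreorder = record
      { isEquivalence = isEquivalence
      ; reflexive     = λ { refl → ≤-refl }
      ; trans         = ≤-trans
      }
    ; antisym = λ ci≤cj cj≤ci → c-injective (≤-antisym ci≤cj cj≤ci)
    }
  ; _≼?_           = λ i j → _≼?_ P (c i) (c j)
  }
  where
  open IsPartialOrder (isPartialOrder P) using ()
    renaming (refl to ≤-refl; trans to ≤-trans; antisym to ≤-antisym)

induced-height≤1 : (P : FinPoset) {k : ℕ} (c : Fin k → Pt P) (c-injective : Injective _≡_ _≡_ c) →
  (∀ i → InE P (c i)) → HeightAtMost1 (induced P c c-injective)
induced-height≤1 P c c-injective c∈E (i , j , l , (ci≤cj , i≢j) , (cj≤cl , j≢l)) with c∈E j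
... | inj₁ cj-min = i≢j (c-injective (cj-min (c i) ci≤cj))
... | inj₂ cj-max = j≢l (sym (c-injective (cj-max (c l) cj≤cl)))

-- CycSucc k i j is definitionally CycSuccℕ k (toℕ i) (toℕ j).
CycSuccℕ : ℕ → ℕ → ℕ → Set
CycSuccℕ k m n = (suc m ≡ n) ⊎ ((suc m ≡ k) × (n ≡ 0))

CycSuccℕ-4-cycle⇒k≤4 : ∀ k a b c d →
  CycSuccℕ k a b → CycSuccℕ k b c → CycSuccℕ k c d → CycSuccℕ k d a → 4 < k → ⊥
CycSuccℕ-4-cycle⇒k≤4 k a b c d (inj₁ refl) (inj₁ refl) (inj₁ refl) (inj₁ ()) _
CycSuccℕ-4-cycle⇒k≤4 k a b c d (inj₁ refl) (inj₁ refl) (inj₁ refl) (inj₂ (refl , refl)) (s≤s (s≤s (s≤s (s≤s ()))))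
CycSuccℕ-4-cycle⇒k≤4 k a b c d (inj₁ refl) (inj₁ refl) (inj₂ (refl , refl)) (inj₁ refl) (s≤s (s≤s (s≤s (s≤s ()))))
CycSuccℕ-4-cycle⇒k≤4 k a b c d (inj₁ refl) (inj₁ refl) (inj₂ (refl , refl)) (inj₂ (() , _)) _
CycSuccℕ-4-cycle⇒k≤4 k a b c d (inj₁ refl) (inj₂ (refl , refl)) (inj₁ refl) (inj₁ refl) (s≤s (s≤s (s≤s (s≤s ()))))
CycSuccℕ-4-cycle⇒k≤4 k a b c d (inj₁ refl) (inj₂ (refl , refl)) (inj₁ refl) (inj₂ (refl , refl)) (s≤s (s≤s ()))
CycSuccℕ-4-cycle⇒k≤4 k a b c d (inj₁ refl) (inj₂ (refl , refl)) (inj₂ (() , _)) _ _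
CycSuccℕ-4-cycle⇒k≤4 k a b c d (inj₂ (refl , refl)) (inj₁ refl) (inj₁ refl) (inj₁ refl) (s≤s (s≤s (s≤s (s≤s ()))))
CycSuccℕ-4-cycle⇒k≤4 k a b c d (inj₂ (refl , refl)) (inj₁ refl) (inj₁ refl) (inj₂ (refl , ())) _
CycSuccℕ-4-cycle⇒k≤4 k a b c d (inj₂ (refl , refl)) (inj₁ refl) (inj₂ (refl , refl)) (inj₁ refl) (s≤s (s≤s ()))
CycSuccℕ-4-cycle⇒k≤4 k a b c d (inj₂ (refl , refl)) (inj₁ refl) (inj₂ (refl , refl)) (inj₂ (() , _)) _
CycSuccℕ-4-cycle⇒k≤4 k a b c d (inj₂ (refl , refl)) (inj₂ (refl , refl)) (inj₁ refl) (inj₁ ()) _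
CycSuccℕ-4-cycle⇒k≤4 k a b c d (inj₂ (refl , refl)) (inj₂ (refl , refl)) (inj₁ refl) (inj₂ (() , _)) _
CycSuccℕ-4-cycle⇒k≤4 k a b c d (inj₂ (refl , refl)) (inj₂ (refl , refl)) (inj₂ (refl , refl)) (inj₁ ()) _
CycSuccℕ-4-cycle⇒k≤4 k a b c d (inj₂ (refl , refl)) (inj₂ (refl , refl)) (inj₂ (refl , refl)) (inj₂ (refl , refl)) (s≤s ())

module _ {k : ℕ} where
  CycSucc-injective : ∀ {i i' j : Fin k} → CycSucc k i j → CycSucc k i' j → i ≡ i'
  CycSucc-injective (inj₁ p) (inj₁ q) = toℕ-injective (suc-injective (trans p (sym q)))
  CycSucc-injective (inj₁ p) (inj₂ (_ , q)) with () ← trans p q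
  CycSucc-injective (inj₂ (_ , q)) (inj₁ p) with () ← trans p q
  CycSucc-injective (inj₂ (p , _)) (inj₂ (q , _)) = toℕ-injective (suc-injective (trans p (sym q)))

  CycSucc-functional : ∀ {i j j' : Fin k} → CycSucc k i j → CycSucc k i j' → j ≡ j'
  CycSucc-functional (inj₁ p) (inj₁ q) = toℕ-injective (trans (sym p) q)
  CycSucc-functional {j = j} (inj₁ p) (inj₂ (q , _)) = ⊥-elim (<-irrefl (trans (sym p) q) (toℕ<n j))
  CycSucc-functional {j' = j'} (inj₂ (q , _)) (inj₁ p) = ⊥-elim (<-irrefl (trans (sym p) q) (toℕ<n j'))
  CycSucc-functional (inj₂ (_ , p)) (inj₂ (_ , q)) = toℕ-injective (trans p (sym q))

  CycAdj-continue-forward : ∀ {i j l : Fin k} → CycSucc k i j → CycAdj k j l → i ≢ l → CycSucc k j l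
  CycAdj-continue-forward _   (inj₁ j→l) _   = j→l
  CycAdj-continue-forward i→j (inj₂ l→j) i≢l = ⊥-elim (i≢l (CycSucc-injective i→j l→j))

  CycAdj-continue-backward : ∀ {i j l : Fin k} → CycSucc k j i → CycAdj k j l → i ≢ l → CycSucc k l j
  CycAdj-continue-backward j→i (inj₁ j→l) i≢l = ⊥-elim (i≢l (CycSucc-functional j→i j→l))
  CycAdj-continue-backward _   (inj₂ l→j) _   = l→j

crown-4-crown-free : (P : FinPoset) (k : ℕ) (c : Fin k → Pt P) (crown : IsCrown P k c) → 4 < k →
  ¬ Contains4Crown (induced P c (proj₁ (proj₂ crown)))
crown-4-crown-free P k c (_ , _ , cycle) 4<k
  (a , b , c' , d , a≢b , a≢c , a≢d , b≢c , b≢d , c≢d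
  , (_ , a~b) , (_ , b~c) , (_ , c~d) , (_ , d~a) , _ , _) = around (adjacent a≢b a~b)
  where
  adjacent : ∀ {i j} → i ≢ j → Comparable P (c i) (c j) → CycAdj k i j
  adjacent {i} {j} i≢j = proj₁ (cycle i j i≢j)

  around : CycAdj k a b → ⊥
  around (inj₁ a→b) = CycSuccℕ-4-cycle⇒k≤4 k _ _ _ _ a→b b→c c→d d→a 4<k
    where
    b→c = CycAdj-continue-forward a→b (adjacent b≢c b~c) a≢c
    c→d = CycAdj-continue-forward b→c (adjacent c≢d c~d) b≢d
    d→a = CycAdj-continue-forward c→d (adjacent (≢-sym a≢d) d~a) (≢-sym a≢c)
  around (inj₂ b→a) = CycSuccℕ-4-cycle⇒k≤4 k _ _ _ _ a→d d→c c→b b→a 4<k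
    where
    c→b = CycAdj-continue-backward b→a (adjacent b≢c b~c) a≢c
    d→c = CycAdj-continue-backward c→b (adjacent c≢d c~d) b≢d
    a→d = CycAdj-continue-backward d→c (adjacent (≢-sym a≢d) d~a) (≢-sym a≢c)

retractOf⇒retractOfE : (P : FinPoset) (k : ℕ) (c : Fin k → Pt P) → (∀ i → InE P (c i)) →
  RetractOf P k c → RetractOfE P k c
retractOf⇒retractOfE P k c c∈E (r , r-hom , r-idem , r-image , r-onto) =
  r , (λ x _ → let i , rx≡ci = r-image x in subst (InE P) (sym rx≡ci) (c∈E i))
    , (λ x y _ _ → r-hom x y)
    , (λ x _ → r-idem x)
    , (λ x _ → r-image x)
    , λ i → let x , rx≡ci = r-onto i in
            c i , c∈E i , trans (cong r (sym rx≡ci)) (trans (r-idem x) rx≡ci)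

retractOfE⇒retractOf : (P : FinPoset) {k : ℕ} (c : Fin k → Pt P) (c-injective : Injective _≡_ _≡_ c) →
  (∀ i → InE P (c i)) → ¬ Contains4Crown (induced P c c-injective) →
  RetractOfE P k c → RetractOf P k c
retractOfE⇒retractOf P {k} c c-injective c∈E no4 (rE , _ , rE-hom , rE-idem , rE-image , rE-onto) =
  c ∘ g , extension-hom , r-idem , (λ x → g x , refl) , r-onto
  where
  index : Pt P → Fin k
  index x with inE? P x
  ... | yes x∈E = proj₁ (rE-image x x∈E)
  ... | no _    = let a , a-min , _ = minimal-below P x in proj₁ (rE-image a (inj₁ a-min))

  c-index : ∀ x → InE P x → c (index x) ≡ rE x
  c-index x x∈E with inE? P x
  ... | yes x∈E' = sym (proj₂ (rE-image x x∈E'))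
  ... | no x∉E   = ⊥-elim (x∉E x∈E)

  index-hom : HomOnE P (induced P c c-injective) index
  index-hom x y x∈E y∈E x≤y =
    subst₂ (_≼_ P) (sym (c-index x x∈E)) (sym (c-index y y∈E)) (rE-hom x y x∈E y∈E x≤y)

  open Extension P (induced P c c-injective) (induced-height≤1 P c c-injective c∈E) no4 index index-hom
    using (extension-hom; extension-agrees) renaming (extension to g)

  r-on-E : ∀ x → InE P x → c (g x) ≡ rE x
  r-on-E x x∈E = trans (cong c (extension-agrees x x∈E)) (c-index x x∈E)

  rE-fixes-crown : ∀ i → rE (c i) ≡ c i
  rE-fixes-crown i = let x , x∈E , rEx≡ci = rE-onto i in
    trans (cong rE (sym rEx≡ci)) (trans (rE-idem x x∈E) rEx≡ci)

  r-idem : ∀ x → c (g (c (g x))) ≡ c (g x)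
  r-idem x = trans (r-on-E (c (g x)) (c∈E (g x))) (rE-fixes-crown (g x))

  r-onto : ∀ i → ∃ λ x → c (g x) ≡ c i
  r-onto i = let x , x∈E , rEx≡ci = rE-onto i in x , trans (r-on-E x x∈E) rEx≡ci

theorem4 :
    ((P Q : FinPoset) → Connected P → 1 < size P → Flat Q → ¬ Contains4Crown Q →
      (f : Pt P → Pt Q) → HomOnE P Q f →
      Σ (Pt P → Pt Q) λ g → Hom P Q g × (∀ x → InE P x → g x ≡ f x))
    × ((P : FinPoset) → Connected P → 1 < size P →
      (k : ℕ) (c : Fin k → Pt P) → IsCrown P k c → 4 < k → (∀ i → InE P (c i)) →
      RetractOf P k c ⇔ RetractOfE P k c)
theorem4 =
    (λ P Q _ _ flat no4 → extension-from-E P Q (proj₂ flat) no4)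
  , λ P _ _ k c crown 4<k c∈E →
      mk⇔ (retractOf⇒retractOfE P k c c∈E)
          (retractOfE⇒retractOf P c (proj₁ (proj₂ crown)) c∈E (crown-4-crown-free P k c crown 4<k))
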